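{- The system $\mathsf{DG}$ proves: for every $Y^2$ satisfying standard extensionality, i.e. $(\forall^{\mathrm{st}}f^1,g^1)\big[(\forall^{\mathrm{st}}n^0)(f(n)=g(n))\rightarrow Y(f)=_0Y(g)\big]$, $Y$ is nonstandard (uniformly) continuous on the Cantor space, i.e. $(\forall f,g\le_1 1)\big(f\approx_1 g\rightarrow Y(f)=Y(g)\big)$.
   Context: Finite types: $0$ is a type and if $\rho,\sigma$ are types so is $\rho\to\sigma$; type $1=0\to0$, $2=1\to0$. $\mathsf{E\text{ - }HA}^{\omega}$ is Heyting arithmetic in all finite types (intuitionistic logic, Gödel's $T$ constants) with extensionality. Equality $=_0$ is primitive; for $\tau=\tau_1\to\dots\to\tau_k\to0$, $x=_\tau y$ abbreviates $(\forall z_1\dots z_k)(xz_1\dots z_k=_0yz_1\dots z_k)$, and $\le_\tau$ likewise. Extensionality $(\mathsf E_{\rho\to\tau})$: $(\forall\varphi)(\forall x,y)(x=_\rho y\to\varphi(x)=_\tau\varphi(y))$, for all types. Binary sequences (elements of the Cantor space): $f\le_1 1$. Strong majorizability (Howard–Bezem): $x\le^*_0 y$ iff $x\le_0 y$; $x\le^*_{\rho\to\sigma}y$ iff for all $u,v$ with $u\le^*_\rho v$: $xu\le^*_\sigma yv$ and $yu\le^*_\sigma yv$. Monotone: $x\le^*x$; $\tilde\forall,\tilde\exists$ range over monotone objects. The language of $\mathsf{DG}$ adds predicates $\mathrm{st}^\sigma$ ("is standard"); $\forall^{\mathrm{st}},\exists^{\mathrm{st}}$ are the relativised quantifiers, $\tilde\forall^{\mathrm{st}},\tilde\exists^{\mathrm{st}}$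 combine both restrictions. Internal = not containing $\mathrm{st}$. For $f,g$ of type 1, $f\approx_1 g$ means $(\forall^{\mathrm{st}}n^0)(f(n)=g(n))$. $\mathsf{DG}$ is $\mathsf{E\text{ - }HA}^\omega$ in the extended language plus: (a) $x=_\sigma y\to(\mathrm{st}(x)\to\mathrm{st}(y))$; (b) $\mathrm{st}(y)\to(x\le^*_\sigma y\to\mathrm{st}(x))$; (c) $\mathrm{st}(t)$ for closed terms $t$; (d) $\mathrm{st}(z)\to(\mathrm{st}(x)\to\mathrm{st}(zx))$; external induction $\Phi(0)\wedge(\forall^{\mathrm{st}}n)(\Phi(n)\to\Phi(n+1))\to(\forall^{\mathrm{st}}n)\Phi(n)$ for any $\Phi$; and for arbitrary $\Phi,\Psi$ and internal $\phi,\psi$: $\mathsf{mAC}^\omega$: $(\tilde\forall^{\mathrm{st}}x)(\tilde\exists^{\mathrm{st}}y)\Phi(x,y)\to(\tilde\exists^{\mathrm{st}}f)(\tilde\forall^{\mathrm{st}}x)(\exists y\le^*f(x))\Phi(x,y)$; $\mathsf R^\omega$: $(\forall x)(\exists^{\mathrm{st}}y)\Phi(x,y)\to(\tilde\exists^{\mathrm{st}}z)(\forall x)(\exists y\le^*z)\Phi(x,y)$; $\mathsf I^\omega$: $(\tilde\forall^{\mathrm{st}}z)(\exists x)(\forall y\le^*z)\phi(x,y)\to(\exists x)(\forall^{\mathrm{st}}y)\phi(x,y)$; $\mathsf{IP}^\omega_{\tilde\forall^{\mathrm{st}}}$: $[(\tilde\forall^{\mathrm{st}}x)\phi(x)\to(\tilde\exists^{\mathrm{st}}y)\Psi(y)]\to(\tilde\exists^{\mathrm{st}}z)[(\tilde\forall^{\mathrm{st}}x)\phi(x)\to(\tilde\exists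 y\le^*z)\Psi(y)]$; $\mathsf M^\omega$: $[(\tilde\forall^{\mathrm{st}}x)\phi(x)\to\psi]\to(\tilde\exists^{\mathrm{st}}y)[(\forall x\le^*y)\phi(x)\to\psi]$; $\mathsf{MAJ}^\omega$: $(\forall^{\mathrm{st}}x)(\exists^{\mathrm{st}}y)(x\le^*y)$. -}

module Defs where

-- Deep embedding of the system DG (E-HA^ω in the language with st,
-- plus the DG axioms), and its derivability relation.

open import Data.List using (List; []; _∷_; map)
open import Data.List.Membership.Propositional using (_∈_)

infixr 30 _⇛_
data Ty : Set where
  ι   : Ty
  _⇛_ : Ty → Ty → Ty

ty1 : Ty
ty1 = ι ⇛ ι

ty2 : Ty
ty2 = ty1 ⇛ ι

Ctx : Set
Ctx = List Ty

data _∋_ : Ctx → Ty → Set where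
  here  : ∀ {Γ σ} → (σ ∷ Γ) ∋ σ
  there : ∀ {Γ σ τ} → Γ ∋ σ → (τ ∷ Γ) ∋ σ

-- Terms of Gödel's T (combinatory version: 0, S, Π (K), Σ (S), R)

infixl 40 _·_
data Tm (Γ : Ctx) : Ty → Set where
  var  : ∀ {σ} → Γ ∋ σ → Tm Γ σ
  _·_  : ∀ {σ τ} → Tm Γ (σ ⇛ τ) → Tm Γ σ → Tm Γ τ
  zer  : Tm Γ ι
  suc' : Tm Γ (ι ⇛ ι)
  Kc   : ∀ {σ τ} → Tm Γ (σ ⇛ τ ⇛ σ)
  Sc   : ∀ {ρ σ τ} → Tm Γ ((ρ ⇛ σ ⇛ τ) ⇛ (ρ ⇛ σ) ⇛ ρ ⇛ τ)
  Rc   : ∀ {ρ} → Tm Γ (ι ⇛ ρ ⇛ (ρ ⇛ ι ⇛ ρ) ⇛ ρ)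

Ren : Ctx → Ctx → Set
Ren Γ Δ = ∀ {σ} → Γ ∋ σ → Δ ∋ σ

liftR : ∀ {Γ Δ τ} → Ren Γ Δ → Ren (τ ∷ Γ) (τ ∷ Δ)
liftR r here      = here
liftR r (there x) = there (r x)

ren : ∀ {Γ Δ σ} → Ren Γ Δ → Tm Γ σ → Tm Δ σ
ren r (var x) = var (r x)
ren r (s · t) = ren r s · ren r t
ren r zer     = zer
ren r suc'    = suc'
ren r Kc      = Kc
ren r Sc      = Sc
ren r Rc      = Rc

wk : ∀ {Γ σ τ} → Tm Γ σ → Tm (τ ∷ Γ) σ
wk = ren there

closedTm : ∀ {Γ σ} → Tm [] σ → Tm Γ σ
closedTm = ren (λ ())

Sub : Ctx → Ctx → Set
Sub Γ Δ = ∀ {σ} → Γ ∋ σ → Tm Δ σ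

liftS : ∀ {Γ Δ τ} → Sub Γ Δ → Sub (τ ∷ Γ) (τ ∷ Δ)
liftS s here      = var here
liftS s (there x) = wk (s x)

sub : ∀ {Γ Δ σ} → Sub Γ Δ → Tm Γ σ → Tm Δ σ
sub s (var x) = s x
sub s (a · b) = sub s a · sub s b
sub s zer     = zer
sub s suc'    = suc'
sub s Kc      = Kc
sub s Sc      = Sc
sub s Rc      = Rc

sub1 : ∀ {Γ σ} → Tm Γ σ → Sub (σ ∷ Γ) Γ
sub1 t here      = t
sub1 t (there x) = var x

subSuc : ∀ {Γ} → Sub (ι ∷ Γ) (ι ∷ Γ)
subSuc here      = suc' · var here
subSuc (there x) = var (there x)

-- bracket abstraction (λ-abstraction is definable from K and S)
lam : ∀ {Γ σ τ} → Tm (σ ∷ Γ) τ → Tm Γ (σ ⇛ τ)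
lam {σ = σ} (var here) = Sc {ρ = σ} {σ = σ ⇛ σ} {τ = σ} · Kc · Kc
lam (var (there x)) = Kc · var x
lam (a · b)         = Sc · lam a · lam b
lam zer             = Kc · zer
lam suc'            = Kc · suc'
lam Kc              = Kc · Kc
lam Sc              = Kc · Sc
lam Rc              = Kc · Rc

-- addition, defined by recursion: plus x y = R y x (λ acc n. S acc)
plus : ∀ {Γ} → Tm Γ (ι ⇛ ι ⇛ ι)
plus = lam (lam (Rc · var here · var (there here)
                    · lam (lam (suc' · var (there here)))))

one0 : ∀ {Γ} → Tm Γ ι
one0 = suc' · zer

one1 : ∀ {Γ} → Tm Γ ty1
one1 = Kc · one0

infixr 20 _⊃_
infixr 22 _∨'_
infixr 24 _∧'_
infix  26 _≐_

data Fm (Γ : Ctx) : Set where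
  _≐_  : Tm Γ ι → Tm Γ ι → Fm Γ
  St   : ∀ σ → Tm Γ σ → Fm Γ
  ⊥'   : Fm Γ
  _∧'_ : Fm Γ → Fm Γ → Fm Γ
  _∨'_ : Fm Γ → Fm Γ → Fm Γ
  _⊃_  : Fm Γ → Fm Γ → Fm Γ
  ∀'   : ∀ σ → Fm (σ ∷ Γ) → Fm Γ
  ∃'   : ∀ σ → Fm (σ ∷ Γ) → Fm Γ

¬' : ∀ {Γ} → Fm Γ → Fm Γ
¬' A = A ⊃ ⊥'

renF : ∀ {Γ Δ} → Ren Γ Δ → Fm Γ → Fm Δ
renF r (s ≐ t)  = ren r s ≐ ren r t
renF r (St σ t) = St σ (ren r t)
renF r ⊥'       = ⊥'
renF r (A ∧' B) = renF r A ∧' renF r B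
renF r (A ∨' B) = renF r A ∨' renF r B
renF r (A ⊃ B)  = renF r A ⊃ renF r B
renF r (∀' σ A) = ∀' σ (renF (liftR r) A)
renF r (∃' σ A) = ∃' σ (renF (liftR r) A)

wkF : ∀ {Γ τ} → Fm Γ → Fm (τ ∷ Γ)
wkF = renF there

subF : ∀ {Γ Δ} → Sub Γ Δ → Fm Γ → Fm Δ
subF s (a ≐ b)  = sub s a ≐ sub s b
subF s (St σ t) = St σ (sub s t)
subF s ⊥'       = ⊥'
subF s (A ∧' B) = subF s A ∧' subF s B
subF s (A ∨' B) = subF s A ∨' subF s B
subF s (A ⊃ B)  = subF s A ⊃ subF s B
subF s (∀' σ A) = ∀' σ (subF (liftS s) A)
subF s (∃' σ A) = ∃' σ (subF (liftS s) A)

infixl 50 _[_]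
_[_] : ∀ {Γ σ} → Fm (σ ∷ Γ) → Tm Γ σ → Fm Γ
A [ t ] = subF (sub1 t) A

data Internal {Γ : Ctx} : Fm Γ → Set where
  i≐ : ∀ {s t} → Internal (s ≐ t)
  i⊥ : Internal ⊥'
  i∧ : ∀ {A B} → Internal A → Internal B → Internal (A ∧' B)
  i∨ : ∀ {A B} → Internal A → Internal B → Internal (A ∨' B)
  i⊃ : ∀ {A B} → Internal A → Internal B → Internal (A ⊃ B)
  i∀ : ∀ {σ A} → Internal A → Internal (∀' σ A)
  i∃ : ∀ {σ A} → Internal A → Internal (∃' σ A)

v0 : ∀ {Γ σ} → Tm (σ ∷ Γ) σ
v0 = var here

v1 : ∀ {Γ σ τ} → Tm (τ ∷ σ ∷ Γ) σ
v1 = var (there here)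

v2 : ∀ {Γ σ τ υ} → Tm (υ ∷ τ ∷ σ ∷ Γ) σ
v2 = var (there (there here))

EqT : ∀ {Γ} σ → Tm Γ σ → Tm Γ σ → Fm Γ
EqT ι       s t = s ≐ t
EqT (σ ⇛ τ) s t = ∀' σ (EqT τ (wk s · v0) (wk t · v0))

Le0 : ∀ {Γ} → Tm Γ ι → Tm Γ ι → Fm Γ
Le0 s t = ∃' ι (plus · wk s · v0 ≐ wk t)

LeT : ∀ {Γ} σ → Tm Γ σ → Tm Γ σ → Fm Γ
LeT ι       s t = Le0 s t
LeT (σ ⇛ τ) s t = ∀' σ (LeT τ (wk s · v0) (wk t · v0))

Maj : ∀ {Γ} σ → Tm Γ σ → Tm Γ σ → Fm Γ
Maj ι       x y = Le0 x y
Maj (σ ⇛ τ) x y =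
  ∀' σ (∀' σ (Maj σ v1 v0 ⊃
     (Maj τ (wk (wk x) · v1) (wk (wk y) · v0)
      ∧' Maj τ (wk (wk y) · v1) (wk (wk y) · v0))))

Mon : ∀ {Γ} σ → Tm Γ σ → Fm Γ
Mon σ t = Maj σ t t

∀st : ∀ {Γ} σ → Fm (σ ∷ Γ) → Fm Γ
∀st σ A = ∀' σ (St σ v0 ⊃ A)

∃st : ∀ {Γ} σ → Fm (σ ∷ Γ) → Fm Γ
∃st σ A = ∃' σ (St σ v0 ∧' A)

∀~st : ∀ {Γ} σ → Fm (σ ∷ Γ) → Fm Γ
∀~st σ A = ∀' σ ((St σ v0 ∧' Mon σ v0) ⊃ A)

∃~st : ∀ {Γ} σ → Fm (σ ∷ Γ) → Fm Γ
∃~st σ A = ∃' σ ((St σ v0 ∧' Mon σ v0) ∧' A)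

∃≤* : ∀ {Γ} σ → Tm Γ σ → Fm (σ ∷ Γ) → Fm Γ
∃≤* σ t A = ∃' σ (Maj σ v0 (wk t) ∧' A)

∀≤* : ∀ {Γ} σ → Tm Γ σ → Fm (σ ∷ Γ) → Fm Γ
∀≤* σ t A = ∀' σ (Maj σ v0 (wk t) ⊃ A)

∃~≤* : ∀ {Γ} σ → Tm Γ σ → Fm (σ ∷ Γ) → Fm Γ
∃~≤* σ t A = ∃' σ (Mon σ v0 ∧' (Maj σ v0 (wk t) ∧' A))

Approx1 : ∀ {Γ} → Tm Γ ty1 → Tm Γ ty1 → Fm Γ
Approx1 f g = ∀st ι (wk f · v0 ≐ wk g · v0)

skip2 : ∀ {Γ σ τ υ} → Ren (τ ∷ σ ∷ Γ) (τ ∷ σ ∷ υ ∷ Γ)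
skip2 = liftR (liftR there)

data Axiom (Γ : Ctx) : Fm Γ → Set where
  eq-refl : (t : Tm Γ ι) → Axiom Γ (t ≐ t)
  eq-subst : (s t : Tm Γ ι) (A : Fm (ι ∷ Γ)) →
             Axiom Γ (s ≐ t ⊃ (A [ s ] ⊃ A [ t ]))
  suc-ne0 : (t : Tm Γ ι) → Axiom Γ (¬' (suc' · t ≐ zer))
  suc-inj : (s t : Tm Γ ι) → Axiom Γ (suc' · s ≐ suc' · t ⊃ s ≐ t)
  K-ax : ∀ {σ τ} (s : Tm Γ σ) (t : Tm Γ τ) → Axiom Γ (EqT σ (Kc · s · t) s)
  S-ax : ∀ {ρ σ τ} (x : Tm Γ (ρ ⇛ σ ⇛ τ)) (y : Tm Γ (ρ ⇛ σ)) (z : Tm Γ ρ) →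
         Axiom Γ (EqT τ (Sc · x · y · z) (x · z · (y · z)))
  R0-ax : ∀ {ρ} (y : Tm Γ ρ) (z : Tm Γ (ρ ⇛ ι ⇛ ρ)) →
          Axiom Γ (EqT ρ (Rc · zer · y · z) y)
  RS-ax : ∀ {ρ} (n : Tm Γ ι) (y : Tm Γ ρ) (z : Tm Γ (ρ ⇛ ι ⇛ ρ)) →
          Axiom Γ (EqT ρ (Rc · (suc' · n) · y · z) (z · (Rc · n · y · z) · n))
  ind : (A : Fm (ι ∷ Γ)) → Internal A →
        Axiom Γ ((A [ zer ] ∧' ∀' ι (A ⊃ subF subSuc A)) ⊃ ∀' ι A)
  ext : ∀ {ρ τ} (φ : Tm Γ (ρ ⇛ τ)) (x y : Tm Γ ρ) →
        Axiom Γ (EqT ρ x y ⊃ EqT τ (φ · x) (φ · y))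
  st-eq  : ∀ {σ} (x y : Tm Γ σ) → Axiom Γ (EqT σ x y ⊃ (St σ x ⊃ St σ y))
  st-maj : ∀ {σ} (x y : Tm Γ σ) → Axiom Γ (St σ y ⊃ (Maj σ x y ⊃ St σ x))
  st-closed : ∀ {σ} (t : Tm [] σ) → Axiom Γ (St σ (closedTm t))
  st-app : ∀ {σ τ} (z : Tm Γ (σ ⇛ τ)) (x : Tm Γ σ) →
           Axiom Γ (St (σ ⇛ τ) z ⊃ (St σ x ⊃ St τ (z · x)))
  ext-ind : (A : Fm (ι ∷ Γ)) →
            Axiom Γ ((A [ zer ] ∧' ∀st ι (A ⊃ subF subSuc A)) ⊃ ∀st ι A)
  mAC : ∀ {ρ τ} (A : Fm (τ ∷ ρ ∷ Γ)) →
        Axiom Γ (∀~st ρ (∃~st τ A) ⊃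
                 ∃~st (ρ ⇛ τ) (∀~st ρ (∃' τ (Maj τ v0 (v2 · v1) ∧' renF skip2 A))))
  Rω : ∀ {σ τ} (A : Fm (τ ∷ σ ∷ Γ)) →
       Axiom Γ (∀' σ (∃st τ A) ⊃
                ∃~st τ (∀' σ (∃' τ (Maj τ v0 v2 ∧' renF skip2 A))))
  Iω : ∀ {σ τ} (A : Fm (τ ∷ σ ∷ Γ)) → Internal A →
       Axiom Γ (∀~st τ (∃' σ (∀' τ (Maj τ v0 v2 ⊃ renF skip2 A))) ⊃
                ∃' σ (∀st τ A))
  IPω : ∀ {σ τ} (φ : Fm (σ ∷ Γ)) → Internal φ → (B : Fm (τ ∷ Γ)) →
        Axiom Γ ((∀~st σ φ ⊃ ∃~st τ B) ⊃
                 ∃~st τ (∀~st σ (renF (liftR there) φ) ⊃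
                         ∃~≤* τ v0 (renF (liftR there) B)))
  Mω : ∀ {σ} (φ : Fm (σ ∷ Γ)) → Internal φ → (ψ : Fm Γ) → Internal ψ →
       Axiom Γ ((∀~st σ φ ⊃ ψ) ⊃
                ∃~st σ (∀≤* σ v0 (renF (liftR there) φ) ⊃ wkF ψ))
  MAJ : ∀ {σ} → Axiom Γ (∀st σ (∃st σ (Maj σ v1 v0)))

data Pf : (Γ : Ctx) → List (Fm Γ) → Fm Γ → Set where
  hyp : ∀ {Γ Δ A} → A ∈ Δ → Pf Γ Δ A
  ax  : ∀ {Γ Δ A} → Axiom Γ A → Pf Γ Δ A
  ⊥E  : ∀ {Γ Δ A} → Pf Γ Δ ⊥' → Pf Γ Δ A
  ∧I  : ∀ {Γ Δ A B} → Pf Γ Δ A → Pf Γ Δ B → Pf Γ Δ (A ∧' B)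
  ∧E₁ : ∀ {Γ Δ A B} → Pf Γ Δ (A ∧' B) → Pf Γ Δ A
  ∧E₂ : ∀ {Γ Δ A B} → Pf Γ Δ (A ∧' B) → Pf Γ Δ B
  ∨I₁ : ∀ {Γ Δ A B} → Pf Γ Δ A → Pf Γ Δ (A ∨' B)
  ∨I₂ : ∀ {Γ Δ A B} → Pf Γ Δ B → Pf Γ Δ (A ∨' B)
  ∨E  : ∀ {Γ Δ A B C} → Pf Γ Δ (A ∨' B) → Pf Γ (A ∷ Δ) C → Pf Γ (B ∷ Δ) C →
        Pf Γ Δ C
  ⊃I  : ∀ {Γ Δ A B} → Pf Γ (A ∷ Δ) B → Pf Γ Δ (A ⊃ B)
  ⊃E  : ∀ {Γ Δ A B} → Pf Γ Δ (A ⊃ B) → Pf Γ Δ A → Pf Γ Δ B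
  ∀I  : ∀ {Γ Δ σ A} → Pf (σ ∷ Γ) (map wkF Δ) A → Pf Γ Δ (∀' σ A)
  ∀E  : ∀ {Γ Δ σ A} → Pf Γ Δ (∀' σ A) → (t : Tm Γ σ) → Pf Γ Δ (A [ t ])
  ∃I  : ∀ {Γ Δ σ A} → (t : Tm Γ σ) → Pf Γ Δ (A [ t ]) → Pf Γ Δ (∃' σ A)
  ∃E  : ∀ {Γ Δ σ A C} → Pf Γ Δ (∃' σ A) → Pf (σ ∷ Γ) (A ∷ map wkF Δ) (wkF C) →
        Pf Γ Δ C

DG⊢ : Fm [] → Set
DG⊢ A = Pf [] [] A

StdExt : ∀ {Γ} → Tm Γ ty2 → Fm Γ
StdExt Y = ∀st ty1 (∀st ty1
  (∀st ι (v2 · v0 ≐ v1 · v0) ⊃ wk (wk Y) · v1 ≐ wk (wk Y) · v0))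

NSCont : ∀ {Γ} → Tm Γ ty2 → Fm Γ
NSCont Y = ∀' ty1 (LeT ty1 v0 one1 ⊃ ∀' ty1 (LeT ty1 v0 one1 ⊃
  (Approx1 v1 v0 ⊃ wk (wk Y) · v1 ≐ wk (wk Y) · v0)))

Thm3-14 : Fm []
Thm3-14 = ∀' ty2 (StdExt v0 ⊃ NSCont v0)

{-# OPTIONS --safe #-}
module Submission where

-- Every f ≤₁ 1 is strongly majorised by the closed, hence standard, term 1,
-- so by axiom (b) every element of Cantor space is standard.  Given
-- f, g ≤₁ 1 with f ≈₁ g, standard extensionality of Y therefore applies
-- to f and g themselves and yields Y f = Y g.

open import Defs
open import Data.Nat using (ℕ; zero; suc)
open import Data.List using (List; []; _∷_)
open import Data.List.Relation.Unary.Any using (here; there)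
open import Data.Product using (Σ; _,_; proj₁; proj₂)
open import Relation.Binary.PropositionalEquality
  using (_≡_; refl; sym; trans; cong; cong₂; subst)

sub-wk : ∀ {Γ Δ σ τ} (s : Sub (τ ∷ Γ) Δ) (a : Tm Γ σ) →
         sub s (wk a) ≡ sub (λ x → s (there x)) a
sub-wk s (var x) = refl
sub-wk s (a · b) = cong₂ _·_ (sub-wk s a) (sub-wk s b)
sub-wk s zer     = refl
sub-wk s suc'    = refl
sub-wk s Kc      = refl
sub-wk s Sc      = refl
sub-wk s Rc      = refl

sub-var : ∀ {Γ σ} (a : Tm Γ σ) → sub var a ≡ a
sub-var (var x) = refl
sub-var (a · b) = cong₂ _·_ (sub-var a) (sub-var b)
sub-var zer     = refl
sub-var suc'    = refl
sub-var Kc      = refl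
sub-var Sc      = refl
sub-var Rc      = refl

ren-sub : ∀ {Γ Δ Θ σ} (s : Sub Γ Δ) (r : Ren Δ Θ) (a : Tm Γ σ) →
          ren r (sub s a) ≡ sub (λ x → ren r (s x)) a
ren-sub s r (var x) = refl
ren-sub s r (a · b) = cong₂ _·_ (ren-sub s r a) (ren-sub s r b)
ren-sub s r zer     = refl
ren-sub s r suc'    = refl
ren-sub s r Kc      = refl
ren-sub s r Sc      = refl
ren-sub s r Rc      = refl

sub1-wk : ∀ {Γ σ τ} (t : Tm Γ τ) (a : Tm Γ σ) → sub (sub1 t) (wk a) ≡ a
sub1-wk t a = trans (sub-wk (sub1 t) a) (sub-var a)

liftS-wk : ∀ {Γ Δ σ τ} (s : Sub Γ Δ) (a : Tm Γ σ) →
           sub (liftS {τ = τ} s) (wk a) ≡ wk (sub s a)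
liftS-wk s a = trans (sub-wk (liftS s) a) (sym (ren-sub s there a))

subF-EqT : ∀ {Γ Δ} τ (s : Sub Γ Δ) (a b : Tm Γ τ) →
           subF s (EqT τ a b) ≡ EqT τ (sub s a) (sub s b)
subF-EqT ι       s a b = refl
subF-EqT (σ ⇛ τ) s a b = cong (∀' σ)
  (trans (subF-EqT τ (liftS s) (wk a · v0) (wk b · v0))
         (cong₂ (λ x y → EqT τ (x · v0) (y · v0)) (liftS-wk s a) (liftS-wk s b)))

module _ {Γ : Ctx} {Δ : List (Fm Γ)} where

  infix 4 ⊢_
  ⊢_ : Fm Γ → Set
  ⊢ A = Pf Γ Δ A

  EqT-app : ∀ {σ τ} {s t : Tm Γ (σ ⇛ τ)} → ⊢ EqT (σ ⇛ τ) s t → (u : Tm Γ σ) →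
            ⊢ EqT τ (s · u) (t · u)
  EqT-app {τ = τ} {s} {t} p u = subst ⊢_
    (trans (subF-EqT τ (sub1 u) (wk s · v0) (wk t · v0))
           (cong₂ (λ x y → EqT τ (x · u) (y · u)) (sub1-wk u s) (sub1-wk u t)))
    (∀E p u)

  ≐-sym : {s t : Tm Γ ι} → ⊢ s ≐ t → ⊢ t ≐ s
  ≐-sym {s} {t} p = subst ⊢_ (cong (t ≐_) (sub1-wk t s))
    (⊃E (⊃E (ax (eq-subst s t (v0 ≐ wk s))) p)
        (subst ⊢_ (cong (s ≐_) (sym (sub1-wk s s))) (ax (eq-refl s))))

  ≐-trans : {s t u : Tm Γ ι} → ⊢ s ≐ t → ⊢ t ≐ u → ⊢ s ≐ u
  ≐-trans {s} {t} {u} p q = subst ⊢_ (cong (_≐ u) (sub1-wk u s))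
    (⊃E (⊃E (ax (eq-subst t u (wk s ≐ v0))) q)
        (subst ⊢_ (cong (_≐ t) (sym (sub1-wk t s))) p))

  data Spine : Ty → Set where
    []  : Spine ι
    _∷_ : ∀ {σ τ} → Tm Γ σ → Spine τ → Spine (σ ⇛ τ)

  apply : ∀ {σ} → Tm Γ σ → Spine σ → Tm Γ ι
  apply h []       = h
  apply h (x ∷ xs) = apply (h · x) xs

  EqT-apply : ∀ {σ} {s t : Tm Γ σ} → ⊢ EqT σ s t → (xs : Spine σ) →
              ⊢ apply s xs ≐ apply t xs
  EqT-apply p []       = p
  EqT-apply p (x ∷ xs) = EqT-apply (EqT-app p x) xs

  Reduct : Tm Γ ι → Set
  Reduct t = Σ (Tm Γ ι) λ u → ⊢ t ≐ u

  stop : (t : Tm Γ ι) → Reduct t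
  stop t = t , ax (eq-refl t)

  step : {t m : Tm Γ ι} → ⊢ t ≐ m → Reduct m → Reduct t
  step p (u , q) = u , ≐-trans p q

  -- Head reduction with fuel; the numeral argument of R is reduced first
  -- and transported into R by extensionality.
  reduce : ℕ → ∀ {σ} (h : Tm Γ σ) (xs : Spine σ) → Reduct (apply h xs)
  reduceR : ℕ → ∀ {ρ} (n : Tm Γ ι) (y : Tm Γ ρ) (z : Tm Γ (ρ ⇛ ι ⇛ ρ))
            (xs : Spine ρ) → Reduct n → Reduct (apply (Rc · n · y · z) xs)
  reduce fuel (f · x) xs = reduce fuel f (x ∷ xs)
  reduce zero h xs = stop _
  reduce (suc fuel) Kc (x ∷ y ∷ xs) =
    step (EqT-apply (ax (K-ax x y)) xs) (reduce fuel x xs)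
  reduce (suc fuel) Sc (x ∷ y ∷ z ∷ xs) =
    step (EqT-apply (ax (S-ax x y z)) xs) (reduce fuel x (z ∷ y · z ∷ xs))
  reduce (suc fuel) Rc (n ∷ y ∷ z ∷ xs) = reduceR fuel n y z xs (reduce fuel n [])
  reduce (suc fuel) h xs = stop _
  reduceR fuel n y z xs (zer , p) =
    step (EqT-apply (⊃E (ax (ext Rc n zer)) p) (y ∷ z ∷ xs))
         (step (EqT-apply (ax (R0-ax y z)) xs) (reduce fuel y xs))
  reduceR fuel n y z xs (suc' · m , p) =
    step (EqT-apply (⊃E (ax (ext Rc n (suc' · m))) p) (y ∷ z ∷ xs))
         (step (EqT-apply (ax (RS-ax m y z)) xs)
               (reduce fuel z (Rc · m · y · z ∷ m ∷ xs)))
  reduceR fuel n y z xs _ = stop _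

  ≐-by-reduction : (fuel : ℕ) (s t : Tm Γ ι) →
                   proj₁ (reduce fuel s []) ≡ proj₁ (reduce fuel t []) → ⊢ s ≐ t
  ≐-by-reduction fuel s t same = ≐-trans (proj₂ (reduce fuel s []))
    (subst (λ u → ⊢ u ≐ t) (sym same) (≐-sym (proj₂ (reduce fuel t []))))

≤-one1⇒≤*-one1 : ∀ {Γ Δ} → Pf Γ Δ (∀' ty1 (LeT ty1 v0 one1 ⊃ Maj ty1 v0 one1))
≤-one1⇒≤*-one1 = ∀I (⊃I (∀I (∀I (⊃I (∧I
  (∃E (∀E (hyp (there (here refl))) v1)
      (∃I v0 (≐-trans (hyp (here refl)) (≐-by-reduction 2 _ _ refl))))
  (∃I zer (≐-by-reduction 30 _ _ refl)))))))

cantor-space-standard : ∀ {Γ Δ} → Pf Γ Δ (∀' ty1 (LeT ty1 v0 one1 ⊃ St ty1 v0))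
cantor-space-standard = ∀I (⊃I
  (⊃E (⊃E (ax (st-maj v0 one1)) (ax (st-closed one1)))
      (⊃E (∀E ≤-one1⇒≤*-one1 v0) (hyp (here refl)))))

theorem3p14 : DG⊢ Thm3-14
theorem3p14 = ∀I (⊃I (∀I (⊃I (∀I (⊃I (⊃I
  (⊃E (⊃E (∀E (⊃E (∀E std-ext f) st-f) g) st-g) (hyp (here refl)))))))))
  where
  Γ₀ : Ctx
  Γ₀ = ty1 ∷ ty1 ∷ ty2 ∷ []
  f g : Tm Γ₀ ty1
  f = var (there here)
  g = var here
  Δ₀ : List (Fm Γ₀)
  Δ₀ = Approx1 f g ∷ LeT ty1 g one1 ∷ LeT ty1 f one1 ∷ StdExt v2 ∷ []
  std-ext : Pf Γ₀ Δ₀ (StdExt v2)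
  std-ext = hyp (there (there (there (here refl))))
  st-f : Pf Γ₀ Δ₀ (St ty1 f)
  st-f = ⊃E (∀E cantor-space-standard f) (hyp (there (there (here refl))))
  st-g : Pf Γ₀ Δ₀ (St ty1 g)
  st-g = ⊃E (∀E cantor-space-standard g) (hyp (there (here refl)))
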